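{- Let $F$ be rule $124$ on the square grid, let $x$ be a finite configuration of dimension $n\times n$ with at least one active cell, $c=c(x)$, and let $u$ be a cell with $c_u=0$ such that the distance $\tau$ from $u$ to the nearest active cell of $c$ satisfies $\tau\ge 2$. Then either $u$ becomes active at time $\tau$, $\tau+1$ or $\tau+2$ (i.e. the least $t$ with $F^t(c)_u=1$ belongs to $\{\tau,\tau+1,\tau+2\}$), or $u$ is stable for $c$.
   Context: Square grid: cells are the elements of $\mathbb{Z}^2$; the neighbors $N(u)$ of $u$ are the four cells at Manhattan distance 1; distance between cells is the Manhattan (graph) distance. Rule $124$: $F(c)_u=1$ if $c_u=1$ or $\sum_{v\in N(u)}c_v\in\{1,2,4\}$, else $F(c)_u=0$, applied synchronously (1 = active, 0 = inactive). For $x:\{0,\dots,n-1\}^2\to\{0,1\}$, $c(x)$ is the periodic configuration obtained by repeating $x$ in all directions. A cell $u$ with $c_u=0$ is stable for $c$ if $F^t(c)_u=0$ for all $t\ge 0$. -}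

module Defs where

open import Data.Bool using (Bool; true; false; _∨_)
open import Data.Nat as ℕ using (ℕ; zero; suc)
open import Data.Integer as ℤ using (ℤ; +_; _-_; ∣_∣)
open import Data.Integer.DivMod using (_%ℕ_; n%ℕd<d)
open import Data.Fin using (Fin; fromℕ<)
open import Data.Product using (_×_; _,_)
open import Relation.Binary.PropositionalEquality using (_≡_)

Cell : Set
Cell = ℤ × ℤ

Config : Set
Config = Cell → Bool

dist : Cell → Cell → ℕ
dist (a , b) (c , d) = ∣ a - c ∣ ℕ.+ ∣ b - d ∣

b2n : Bool → ℕ
b2n true = 1
b2n false = 0

nbSum : Config → Cell → ℕ
nbSum c (i , j) =
  b2n (c (i ℤ.+ ℤ.1ℤ , j)) ℕ.+ b2n (c (i - ℤ.1ℤ , j)) ℕ.+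
  b2n (c (i , j ℤ.+ ℤ.1ℤ)) ℕ.+ b2n (c (i , j - ℤ.1ℤ))

in124 : ℕ → Bool
in124 1 = true
in124 2 = true
in124 4 = true
in124 _ = false

F : Config → Config
F c u = c u ∨ in124 (nbSum c u)

iter : ℕ → Config → Config
iter zero c = c
iter (suc t) c = F (iter t c)

-- Periodic configuration c(x) obtained from an n×n pattern, n = suc m.
periodic : (m : ℕ) → (Fin (suc m) → Fin (suc m) → Bool) → Config
periodic m x (i , j) =
  x (fromℕ< (n%ℕd<d i (suc m))) (fromℕ< (n%ℕd<d j (suc m)))

Stable : Config → Cell → Set
Stable c u = ∀ t → iter t c u ≡ false

module Submission where

-- Rule 124 on ℤ²: a cell becomes active when it is active already or when
-- 1, 2 or 4 of its neighbours are active; an inactive cell therefore stays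
-- inactive exactly when it sees 0 or 3 active neighbours.
--
-- The theorem holds for every initial configuration c.  Let τ ≥ 1 be
-- the distance from u to the support of c.  Activity spreads by at most one
-- cell per step (light cone), so u is inactive before time τ.  If u is not
-- active at time τ, it saw 0 or 3 active neighbours at time τ-1:
--   * 0 active neighbours: the key lemma `isolated-is-walled` shows that every
--     neighbour of u then has its three other neighbours active, so u and its
--     neighbours form a "trap" that never changes;
--   * 3 active neighbours, the gap being z: u activates at τ+1 or τ+2 if z
--     activates at τ or τ+1; otherwise z (like u before) is either isolated
--     and walled, or u and z form a domino surrounded by active cells; both
--     patterns are traps, and u is stable.

open import Defs
open import Data.Bool using (Bool; true; false; _∨_)
open import Data.Bool.Properties using (∨-zeroʳ)
open import Data.Nat using (ℕ; zero; suc; _+_; _≤_; _<_; z≤n; s≤s; _≤′_; ≤′-refl; ≤′-step)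
open import Data.Nat.Properties
  using (≤-refl; ≤-reflexive; ≤-trans; ≤-pred; ≤⇒≤′; n≤1+n; m≤n⇒m≤1+n; m≤m+n; m≤n+m;
         <⇒≱; +-comm; +-suc; +-monoˡ-≤; +-monoʳ-≤; suc-injective; m+n≡0⇒m≡0; m+n≡0⇒n≡0; n≤0⇒n≡0)
open import Data.Integer as ℤ using (+_; -[1+_]; ∣_∣)
open import Data.Integer.Properties using (∣i+j∣≤∣i∣+∣j∣; ∣i-j∣≤∣i∣+∣j∣; ∣i∣≡0⇒i≡0; i-j≡0⇒i≡j; +-inverseʳ)
open import Data.Integer.Tactic.RingSolver using (solve-∀)
open import Data.Fin using (Fin)
open import Data.Product using (∃; _×_; _,_; proj₁)
open import Data.Sum using (_⊎_; inj₁; inj₂)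
open import Data.Empty using (⊥-elim)
open import Relation.Nullary using (Dec; yes; no)
open import Relation.Binary.PropositionalEquality using (_≡_; _≢_; refl; sym; trans; cong; cong₂; subst)

data Dir : Set where
  E W N S : Dir

step : Dir → Cell → Cell
step E (i , j) = (i ℤ.+ ℤ.1ℤ , j)
step W (i , j) = (i ℤ.- ℤ.1ℤ , j)
step N (i , j) = (i , j ℤ.+ ℤ.1ℤ)
step S (i , j) = (i , j ℤ.- ℤ.1ℤ)

opp : Dir → Dir
opp E = W
opp W = E
opp N = S
opp S = N

rot : Dir → Dir
rot E = N
rot N = W
rot W = S
rot S = E

_≟D_ : (a b : Dir) → Dec (a ≡ b)
E ≟D E = yes refl
E ≟D W = no λ ()
E ≟D N = no λ ()
E ≟D S = no λ ()
W ≟D E = no λ ()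
W ≟D W = yes refl
W ≟D N = no λ ()
W ≟D S = no λ ()
N ≟D E = no λ ()
N ≟D W = no λ ()
N ≟D N = yes refl
N ≟D S = no λ ()
S ≟D E = no λ ()
S ≟D W = no λ ()
S ≟D N = no λ ()
S ≟D S = yes refl

rot≢opp : ∀ e → rot e ≢ opp e
rot≢opp E ()
rot≢opp W ()
rot≢opp N ()
rot≢opp S ()

opp≢opp-rot : ∀ e → opp e ≢ opp (rot e)
opp≢opp-rot E ()
opp≢opp-rot W ()
opp≢opp-rot N ()
opp≢opp-rot S ()

rot≢opp-opp : ∀ e → rot e ≢ opp (opp e)
rot≢opp-opp E ()
rot≢opp-opp W ()
rot≢opp-opp N ()
rot≢opp-opp S ()

+1-1 : ∀ a → (a ℤ.+ ℤ.1ℤ) ℤ.- ℤ.1ℤ ≡ a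
+1-1 = solve-∀

-1+1 : ∀ a → (a ℤ.- ℤ.1ℤ) ℤ.+ ℤ.1ℤ ≡ a
-1+1 = solve-∀

cancel : ∀ e w → step (opp e) (step e w) ≡ w
cancel E (i , j) = cong (_, j) (+1-1 i)
cancel W (i , j) = cong (_, j) (-1+1 i)
cancel N (i , j) = cong (i ,_) (+1-1 j)
cancel S (i , j) = cong (i ,_) (-1+1 j)

step-comm : ∀ e f w → step e (step f w) ≡ step f (step e w)
step-comm E E w = refl
step-comm W W w = refl
step-comm N N w = refl
step-comm S S w = refl
step-comm E W (i , j) = cong (_, j) (trans (-1+1 i) (sym (+1-1 i)))
step-comm W E (i , j) = cong (_, j) (trans (+1-1 i) (sym (-1+1 i)))
step-comm N S (i , j) = cong (i ,_) (trans (-1+1 j) (sym (+1-1 j)))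
step-comm S N (i , j) = cong (i ,_) (trans (+1-1 j) (sym (-1+1 j)))
step-comm E N (i , j) = refl
step-comm E S (i , j) = refl
step-comm W N (i , j) = refl
step-comm W S (i , j) = refl
step-comm N E (i , j) = refl
step-comm N W (i , j) = refl
step-comm S E (i , j) = refl
step-comm S W (i , j) = refl

offset+1 : ∀ a p → (a ℤ.+ ℤ.1ℤ) ℤ.- p ≡ (a ℤ.- p) ℤ.+ ℤ.1ℤ
offset+1 = solve-∀

offset-1 : ∀ a p → (a ℤ.- ℤ.1ℤ) ℤ.- p ≡ (a ℤ.- p) ℤ.- ℤ.1ℤ
offset-1 = solve-∀

∣offset+1∣≤ : ∀ a p → ∣ (a ℤ.+ ℤ.1ℤ) ℤ.- p ∣ ≤ suc ∣ a ℤ.- p ∣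
∣offset+1∣≤ a p rewrite offset+1 a p =
  ≤-trans (∣i+j∣≤∣i∣+∣j∣ (a ℤ.- p) ℤ.1ℤ) (≤-reflexive (+-comm ∣ a ℤ.- p ∣ 1))

∣offset-1∣≤ : ∀ a p → ∣ (a ℤ.- ℤ.1ℤ) ℤ.- p ∣ ≤ suc ∣ a ℤ.- p ∣
∣offset-1∣≤ a p rewrite offset-1 a p =
  ≤-trans (∣i-j∣≤∣i∣+∣j∣ (a ℤ.- p) ℤ.1ℤ) (≤-reflexive (+-comm ∣ a ℤ.- p ∣ 1))

∣offset-1∣-shrinks : ∀ a p n → a ℤ.- p ≡ + suc n → ∣ (a ℤ.- ℤ.1ℤ) ℤ.- p ∣ ≡ n
∣offset-1∣-shrinks a p n eq rewrite offset-1 a p | eq = refl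

∣offset+1∣-shrinks : ∀ a p n → a ℤ.- p ≡ -[1+ n ] → ∣ (a ℤ.+ ℤ.1ℤ) ℤ.- p ∣ ≡ n
∣offset+1∣-shrinks a p n eq rewrite offset+1 a p | eq = ∣-[1+n]+1∣ n
  where
  ∣-[1+n]+1∣ : ∀ n → ∣ -[1+ n ] ℤ.+ ℤ.1ℤ ∣ ≡ n
  ∣-[1+n]+1∣ zero = refl
  ∣-[1+n]+1∣ (suc n) = refl

dist-step : ∀ e w v → dist (step e w) v ≤ suc (dist w v)
dist-step E (a , b) (p , q) = +-monoˡ-≤ ∣ b ℤ.- q ∣ (∣offset+1∣≤ a p)
dist-step W (a , b) (p , q) = +-monoˡ-≤ ∣ b ℤ.- q ∣ (∣offset-1∣≤ a p)
dist-step N (a , b) (p , q) =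
  ≤-trans (+-monoʳ-≤ ∣ a ℤ.- p ∣ (∣offset+1∣≤ b q)) (≤-reflexive (+-suc ∣ a ℤ.- p ∣ ∣ b ℤ.- q ∣))
dist-step S (a , b) (p , q) =
  ≤-trans (+-monoʳ-≤ ∣ a ℤ.- p ∣ (∣offset-1∣≤ b q)) (≤-reflexive (+-suc ∣ a ℤ.- p ∣ ∣ b ℤ.- q ∣))

dist-geodesic : ∀ w v m → dist w v ≡ suc m → ∃ λ e → dist (step e w) v ≡ m
dist-geodesic (a , b) (p , q) m h with a ℤ.- p in δa
... | + suc n = W , trans (cong (_+ ∣ b ℤ.- q ∣) (∣offset-1∣-shrinks a p n δa)) (suc-injective h)
... | -[1+ n ] = E , trans (cong (_+ ∣ b ℤ.- q ∣) (∣offset+1∣-shrinks a p n δa)) (suc-injective h)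
... | + zero with b ℤ.- q in δb
...   | + suc n = S , trans (cong₂ _+_ (cong ∣_∣ δa) (∣offset-1∣-shrinks b q n δb)) (suc-injective h)
...   | -[1+ n ] = N , trans (cong₂ _+_ (cong ∣_∣ δa) (∣offset+1∣-shrinks b q n δb)) (suc-injective h)

dist≡0⇒≡ : ∀ w v → dist w v ≡ 0 → w ≡ v
dist≡0⇒≡ (a , b) (p , q) h =
  cong₂ _,_ (i-j≡0⇒i≡j a p (∣i∣≡0⇒i≡0 (m+n≡0⇒m≡0 ∣ a ℤ.- p ∣ h)))
            (i-j≡0⇒i≡j b q (∣i∣≡0⇒i≡0 (m+n≡0⇒n≡0 ∣ a ℤ.- p ∣ h)))

dist-refl : ∀ w → dist w w ≡ 0
dist-refl (a , b) rewrite +-inverseʳ a | +-inverseʳ b = refl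

count : (Dir → Bool) → ℕ
count h = b2n (h E) + b2n (h W) + b2n (h N) + b2n (h S)

nbSum≡count : ∀ g y → nbSum g y ≡ count (λ e → g (step e y))
nbSum≡count g (i , j) = refl

count-none : ∀ h → (∀ e → h e ≡ false) → count h ≡ 0
count-none h off rewrite off E | off W | off N | off S = refl

count-all : ∀ h → (∀ e → h e ≡ true) → count h ≡ 4
count-all h on rewrite on E | on W | on N | on S = refl

count-three : ∀ h d → h d ≡ false → (∀ e → e ≢ d → h e ≡ true) → count h ≡ 3
count-three h E off on rewrite off | on W (λ ()) | on N (λ ()) | on S (λ ()) = refl
count-three h W off on rewrite on E (λ ()) | off | on N (λ ()) | on S (λ ()) = refl
count-three h N off on rewrite on E (λ ()) | on W (λ ()) | off | on S (λ ()) = refl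
count-three h S off on rewrite on E (λ ()) | on W (λ ()) | on N (λ ()) | off = refl

count-in124 : ∀ h → in124 (count h) ≡ true → ∃ λ e → h e ≡ true
count-in124 h p with h E in hE | h W in hW | h N in hN | h S in hS
... | true | _ | _ | _ = E , hE
... | false | true | _ | _ = W , hW
... | false | false | true | _ = N , hN
... | false | false | false | true = S , hS
count-in124 h () | false | false | false | false

count-∉124 : ∀ h → in124 (count h) ≡ false →
  (∀ e → h e ≡ false) ⊎ ∃ λ d → h d ≡ false × (∀ e → e ≢ d → h e ≡ true)
count-∉124 h p with h E in hE | h W in hW | h N in hN | h S in hS
count-∉124 h () | true | true | true | true
... | true | true | true | false = inj₂ (S , hS , λ { E _ → hE ; W _ → hW ; N _ → hN ; S S≢S → ⊥-elim (S≢S refl) })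
... | true | true | false | true = inj₂ (N , hN , λ { E _ → hE ; W _ → hW ; S _ → hS ; N N≢N → ⊥-elim (N≢N refl) })
count-∉124 h () | true | true | false | false
... | true | false | true | true = inj₂ (W , hW , λ { E _ → hE ; N _ → hN ; S _ → hS ; W W≢W → ⊥-elim (W≢W refl) })
count-∉124 h () | true | false | true | false
count-∉124 h () | true | false | false | true
count-∉124 h () | true | false | false | false
... | false | true | true | true = inj₂ (E , hE , λ { W _ → hW ; N _ → hN ; S _ → hS ; E E≢E → ⊥-elim (E≢E refl) })
count-∉124 h () | false | true | true | false
count-∉124 h () | false | true | false | true
count-∉124 h () | false | true | false | false
count-∉124 h () | false | false | true | true
count-∉124 h () | false | false | true | false
count-∉124 h () | false | false | false | true
... | false | false | false | false = inj₁ λ { E → hE ; W → hW ; N → hN ; S → hS }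

NoActiveNeighbour : Config → Cell → Set
NoActiveNeighbour g y = ∀ e → g (step e y) ≡ false

ActiveExcept : Config → Cell → Dir → Set
ActiveExcept g y d = ∀ e → e ≢ d → g (step e y) ≡ true

Walled : Config → Cell → Set
Walled g w = ∀ d → ActiveExcept g (step d w) (opp d)

Around : Cell → Cell → Set
Around w y = y ≡ w ⊎ ∃ λ d → y ≡ step d w

on-off-absurd : {A : Set} {b : Bool} → b ≡ true → b ≡ false → A
on-off-absurd refl ()

F-active : ∀ g y → g y ≡ true → F g y ≡ true
F-active g y on = cong (_∨ in124 (nbSum g y)) on

F-source : ∀ g y → F g y ≡ true → g y ≡ true ⊎ ∃ λ e → g (step e y) ≡ true
F-source g y p with g y
... | true = inj₁ refl
... | false = inj₂ (count-in124 _ (trans (cong in124 (sym (nbSum≡count g y))) p))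

F-surrounded : ∀ g y → (∀ e → g (step e y) ≡ true) → F g y ≡ true
F-surrounded g y on =
  trans (cong (λ s → g y ∨ in124 s) (trans (nbSum≡count g y) (count-all _ on))) (∨-zeroʳ (g y))

F-isolated : ∀ g y → g y ≡ false → NoActiveNeighbour g y → F g y ≡ false
F-isolated g y off quiet =
  cong₂ _∨_ off (cong in124 (trans (nbSum≡count g y) (count-none _ quiet)))

F-three : ∀ g y d → g y ≡ false → g (step d y) ≡ false → ActiveExcept g y d → F g y ≡ false
F-three g y d off gap others =
  cong₂ _∨_ off (cong in124 (trans (nbSum≡count g y) (count-three _ d gap others)))

F-inactive : ∀ g y → F g y ≡ false →
  g y ≡ false × (NoActiveNeighbour g y ⊎ ∃ λ d → g (step d y) ≡ false × ActiveExcept g y d)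
F-inactive g y p with g y
... | false = refl , count-∉124 _ (trans (cong in124 (sym (nbSum≡count g y))) p)

module Dynamics (c : Config) where

  active-persists : ∀ {s t} y → s ≤ t → iter s c y ≡ true → iter t c y ≡ true
  active-persists y s≤t = go (≤⇒≤′ s≤t)
    where
    go : ∀ {s t} → s ≤′ t → iter s c y ≡ true → iter t c y ≡ true
    go ≤′-refl on = on
    go {t = suc t} (≤′-step s≤t) on = F-active (iter t c) y (go s≤t on)

  inactive-before : ∀ {s t} y → s ≤ t → iter t c y ≡ false → iter s c y ≡ false
  inactive-before {s} y s≤t off with iter s c y in on
  ... | false = refl
  ... | true = on-off-absurd (active-persists y s≤t on) off

  off-before : ∀ {t} y → iter t c y ≡ false → ∀ s → s < suc t → iter s c y ≡ false
  off-before y off s s< = inactive-before y (≤-pred s<) off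

  ActiveExcept-persists : ∀ {s t} y d → s ≤ t → ActiveExcept (iter s c) y d → ActiveExcept (iter t c) y d
  ActiveExcept-persists y d s≤t on e e≢d = active-persists (step e y) s≤t (on e e≢d)

  Near : Cell → ℕ → Set
  Near y s = ∃ λ v → c v ≡ true × dist y v ≤ s

  near-step : ∀ e y {s} → Near y s → Near (step e y) (suc s)
  near-step e y (v , on , le) = v , on , ≤-trans (dist-step e y v) (s≤s le)

  near-zero : ∀ y → Near y 0 → c y ≡ true
  near-zero y (v , on , le) = subst (λ z → c z ≡ true) (sym (dist≡0⇒≡ y v (n≤0⇒n≡0 le))) on

  near-back : ∀ y k → Near y (suc k) → c y ≡ true ⊎ ∃ λ e → Near (step e y) k
  near-back y k (v , on , le) with dist y v in d
  ... | zero = inj₁ (subst (λ z → c z ≡ true) (sym (dist≡0⇒≡ y v d)) on)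
  ... | suc m with dist-geodesic y v m d
  ...   | e , closer = inj₂ (e , v , on , subst (_≤ k) (sym closer) (≤-pred le))

  light-cone : ∀ s y → iter s c y ≡ true → Near y s
  light-cone zero y on = y , on , ≤-reflexive (dist-refl y)
  light-cone (suc s) y on with F-source (iter s c) y on
  ... | inj₁ on′ with light-cone s y on′
  ...   | v , v-on , le = v , v-on , m≤n⇒m≤1+n le
  light-cone (suc s) y on | inj₂ (e , on′) =
    subst (λ z → Near z (suc s)) (cancel e y) (near-step (opp e) (step e y) (light-cone s (step e y) on′))

  inactive-within : ∀ t y → (∀ v → c v ≡ true → t ≤ dist y v) → ∀ s → s < t → iter s c y ≡ false
  inactive-within t y far s s<t with iter s c y in on
  ... | false = refl
  ... | true with light-cone s y on
  ...   | v , v-on , le = ⊥-elim (<⇒≱ s<t (≤-trans (far v v-on) le))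

  -- Counts 0 and 3 are then preserved, so the set never changes.
  Trap : ℕ → (Cell → Set) → Set
  Trap t X = ∀ y → X y →
    iter t c y ≡ false × ((∀ e → X (step e y)) ⊎ ∃ λ d → X (step d y) × ActiveExcept (iter t c) y d)

  trap-stable : ∀ t X → Trap t X → ∀ y → X y → Stable c y
  trap-stable t X trap y Xy s = inactive-before y (m≤m+n s t) (trapped s y Xy)
    where
    trapped : ∀ n y → X y → iter (n + t) c y ≡ false
    trapped zero y Xy = proj₁ (trap y Xy)
    trapped (suc n) y Xy with trap y Xy
    ... | _ , inj₁ all-in = F-isolated (iter (n + t) c) y (trapped n y Xy) (λ e → trapped n (step e y) (all-in e))
    ... | _ , inj₂ (d , Xd , others) =
      F-three (iter (n + t) c) y d (trapped n y Xy) (trapped n (step d y) Xd)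
              (ActiveExcept-persists y d (m≤n+m t n) others)

  walled-stable : ∀ t w → iter t c w ≡ false → NoActiveNeighbour (iter t c) w → Walled (iter t c) w →
                  ∀ y → Around w y → Stable c y
  walled-stable t w off quiet walled = trap-stable t (Around w) trap
    where
    trap : Trap t (Around w)
    trap y (inj₁ refl) = off , inj₁ (λ e → inj₂ (e , refl))
    trap y (inj₂ (d , refl)) = quiet d , inj₂ (opp d , inj₁ (cancel d w) , walled d)

  domino-stable : ∀ t u d → iter t c u ≡ false → iter t c (step d u) ≡ false →
                  ActiveExcept (iter t c) u d → ActiveExcept (iter t c) (step d u) (opp d) → Stable c u
  domino-stable t u d u-off z-off u-others z-others = trap-stable t Pair trap u (inj₁ refl)
    where
    Pair : Cell → Set
    Pair y = y ≡ u ⊎ y ≡ step d u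
    trap : Trap t Pair
    trap y (inj₁ refl) = u-off , inj₂ (d , inj₂ refl , u-others)
    trap y (inj₂ refl) = z-off , inj₂ (opp d , inj₁ (cancel d u) , z-others)

  -- Induction on k: each neighbour close to the support must have its three outer
  -- neighbours active (the alternative contradicts the induction hypothesis), and
  -- these active cells bring the remaining neighbours close to the support.
  isolated-is-walled : ∀ k w → Near w (suc k) → iter (suc k) c w ≡ false →
                       NoActiveNeighbour (iter k c) w → Walled (iter k c) w
  isolated-is-walled zero w near off quiet with near-back w 0 near
  ... | inj₁ on = on-off-absurd (active-persists w (z≤n {1}) on) off
  ... | inj₂ (e , near-e) = on-off-absurd (near-zero (step e w) near-e) (quiet e)
  isolated-is-walled (suc k) w near off quiet d =
    ActiveExcept-persists (step d w) (opp d) (n≤1+n k) (facing d (all-near d))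
    where
    facing : ∀ e → Near (step e w) (suc k) → ActiveExcept (iter k c) (step e w) (opp e)
    facing e near-e with F-inactive (iter k c) (step e w) (quiet e)
    ... | _ , inj₁ quiet-e =
      let beside = isolated-is-walled k (step e w) near-e (quiet e) quiet-e (opp e) (rot e) (rot≢opp-opp e)
          beside-w = subst (λ z → iter k c (step (rot e) z) ≡ true) (cancel e w) beside
      in on-off-absurd (active-persists (step (rot e) w) (n≤1+n k) beside-w) (quiet (rot e))
    ... | _ , inj₂ (d′ , _ , others) with d′ ≟D opp e
    ...   | yes refl = others
    ...   | no d′≢ =
      on-off-absurd (active-persists w (≤-trans (n≤1+n k) (n≤1+n (suc k)))
                      (subst (λ z → iter k c z ≡ true) (cancel e w) (others (opp e) (λ eq → d′≢ (sym eq)))))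
                    off

    spread : ∀ e → ActiveExcept (iter k c) (step e w) (opp e) → ∀ f → f ≢ opp e → Near (step f w) (suc k)
    spread e others f f≢ = subst (λ z → Near z (suc k)) back
      (near-step (opp e) (step f (step e w)) (light-cone k _ (others f f≢)))
      where
      back : step (opp e) (step f (step e w)) ≡ step f w
      back = trans (cong (step (opp e)) (step-comm f e w)) (cancel e (step f w))

    start : ∃ λ e → Near (step e w) (suc k)
    start with near-back w (suc k) near
    ... | inj₁ on = on-off-absurd (active-persists w (z≤n {suc (suc k)}) on) off
    ... | inj₂ close = close

    all-near : ∀ f → Near (step f w) (suc k)
    all-near f with start
    ... | e , near-e with f ≟D opp e
    ...   | no f≢ = spread e (facing e near-e) f f≢
    ...   | yes refl =
      spread (rot e) (facing (rot e) (spread e (facing e near-e) (rot e) (rot≢opp e))) (opp e) (opp≢opp-rot e)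

  FirstActiveAt : ℕ → Cell → Set
  FirstActiveAt t u = iter t c u ≡ true × (∀ s → s < t → iter s c u ≡ false)

  Outcome : Cell → ℕ → Set
  Outcome u τ = (∃ λ t → (t ≡ τ ⊎ t ≡ τ + 1 ⊎ t ≡ τ + 2) × FirstActiveAt t u) ⊎ Stable c u

  surrounded : ∀ {τ t} u d → τ ≤ t → ActiveExcept (iter τ c) u d → iter t c (step d u) ≡ true →
               ∀ e → iter t c (step e u) ≡ true
  surrounded u d τ≤t others z-on e with e ≟D d
  ... | yes refl = z-on
  ... | no e≢d = active-persists (step e u) τ≤t (others e e≢d)

  gap-case : ∀ τ u d → Near u τ → iter τ c u ≡ false → ActiveExcept (iter τ c) u d → Outcome u τ
  gap-case τ u d near off others with iter τ c (step d u) in z₀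
  ... | true =
    inj₁ (suc τ , inj₂ (inj₁ (+-comm 1 τ)) ,
          F-surrounded (iter τ c) u (surrounded {τ} u d ≤-refl others z₀) , off-before u off)
  ... | false with iter (suc τ) c (step d u) in z₁
  ...   | true =
    inj₁ (suc (suc τ) , inj₂ (inj₂ (+-comm 2 τ)) ,
          F-surrounded (iter (suc τ) c) u (surrounded {τ} u d (n≤1+n τ) others z₁) ,
          off-before u (F-three (iter τ c) u d off z₀ others))
  ...   | false with F-inactive (iter τ c) (step d u) z₁
  ...     | _ , inj₁ z-quiet =
    inj₂ (walled-stable τ (step d u) z₀ z-quiet
            (isolated-is-walled τ (step d u) (near-step d u near) z₁ z-quiet)
            u (inj₂ (opp d , sym (cancel d u))))
  ...     | _ , inj₂ (d′ , _ , z-others) with d′ ≟D opp d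
  ...       | yes refl = inj₂ (domino-stable τ u d off z₀ others z-others)
  ...       | no d′≢ =
    on-off-absurd (subst (λ y → iter τ c y ≡ true) (cancel d u) (z-others (opp d) (λ eq → d′≢ (sym eq)))) off

  activation-or-stable : ∀ τ′ u → Near u (suc τ′) → (∀ v → c v ≡ true → suc τ′ ≤ dist u v) → Outcome u (suc τ′)
  activation-or-stable τ′ u near far with iter (suc τ′) c u in u-at-τ
  ... | true = inj₁ (suc τ′ , inj₁ refl , u-at-τ , inactive-within (suc τ′) u far)
  ... | false with F-inactive (iter τ′ c) u u-at-τ
  ...   | off , inj₁ quiet =
    inj₂ (walled-stable τ′ u off quiet (isolated-is-walled τ′ u near u-at-τ quiet) u (inj₁ refl))
  ...   | _ , inj₂ (d , _ , others) =
    gap-case (suc τ′) u d near u-at-τ (ActiveExcept-persists u d (n≤1+n τ′) others)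

lemma8 : (m : ℕ) (x : Fin (suc m) → Fin (suc m) → Bool) →
    (∃ λ i → ∃ λ j → x i j ≡ true) →
    (u : Cell) → periodic m x u ≡ false →
    (τ : ℕ) →
    (∃ λ v → periodic m x v ≡ true × dist u v ≡ τ) →
    (∀ v → periodic m x v ≡ true → τ ≤ dist u v) →
    2 ≤ τ →
    (∃ λ t → (t ≡ τ ⊎ t ≡ τ + 1 ⊎ t ≡ τ + 2) ×
       iter t (periodic m x) u ≡ true ×
       (∀ s → s < t → iter s (periodic m x) u ≡ false))
    ⊎ Stable (periodic m x) u
lemma8 m x _ u _ (suc τ′) (v , v-on , dist≡τ) far _ =
  Dynamics.activation-or-stable (periodic m x) τ′ u (v , v-on , ≤-reflexive dist≡τ) far
lemma8 m x _ u _ zero _ _ ()
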